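{- Let $q\ge1$, $\Sigma=\{0,1,\ldots,q-1\}$, let $n$ be odd, let $T\in BBF_n^q$ and let $T'\in\psi(T)$. Then $T'\notin BBF_{n+1}^q$ if and only if $T'$ has one and only one bibifix of dimension $\frac{n+1}{2}\times\frac{n+1}{2}$ belonging to $BBF_{\frac{n+1}{2}}^q$.
   Context: For an $m\times m$ matrix $T$ over $\Sigma$ and $1\le r<m$, the $r\times r$ biprefix of $T$ is $T[1\ldots r,1\ldots r]$ and the $r\times r$ bisuffix is $T[m-r+1\ldots m,\,m-r+1\ldots m]$. A bibifix of $T$ of dimension $r\times r$ is an $r\times r$ matrix which equals both the $r\times r$ biprefix and the $r\times r$ bisuffix of $T$. $T$ is bibifix-free if it has no bibifix. $BBF_m^q$ denotes the set of all $m\times m$ bibifix-free matrices over $\Sigma$. For an $n\times n$ matrix $M$ over $\Sigma$, let $h=\lfloor n/2\rfloor$; $\psi(M)$ is the set of all $(n+1)\times(n+1)$ matrices $T'$ over $\Sigma$ obtained by inserting into $M$ a new row and a new column, both at position $h+1$, with arbitrary entries; precisely, $T'[i,j]=M[\iota(i),\iota(j)]$ for all $i,j\neq h+1$, where $\iota(i)=i$ if $i\le h$ and $\iota(i)=i-1$ if $i\ge h+2$, while row $h+1$ and column $h+1$ of $T'$ are arbitrary. -}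

module Defs where

open import Data.Nat using (ℕ; zero; suc; _+_; _∸_; _≤_; _<_)
open import Data.Nat.Properties using (m∸n+n≡m; ≤-trans; +-monoˡ-<; <⇒≤)
open import Data.Fin using (Fin; toℕ; fromℕ<; punchOut)
open import Data.Fin.Properties using (toℕ<n)
open import Data.Product using (Σ; ∃; _×_; _,_; ∃!)
open import Relation.Binary.PropositionalEquality using (_≡_; _≢_; sym; subst)
open import Relation.Nullary using (¬_)

-- An m×m matrix over Σ = {0,…,q-1}; indices are 0-based.
Mat : ℕ → ℕ → Set
Mat q m = Fin m → Fin m → Fin q

_≈ₘ_ : ∀ {q r} → Mat q r → Mat q r → Set
A ≈ₘ B = ∀ i j → A i j ≡ B i j

biprefix : ∀ {q m} (T : Mat q m) (r : ℕ) → r ≤ m → Mat q r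
biprefix T r r≤m i j =
  T (fromℕ< (≤-trans (toℕ<n i) r≤m)) (fromℕ< (≤-trans (toℕ<n j) r≤m))

sufIdx : ∀ {m r} → r ≤ m → Fin r → Fin m
sufIdx {m} {r} r≤m i = fromℕ< {(m ∸ r) + toℕ i} lt
  where
  open import Data.Nat.Properties using (+-monoʳ-<; m+[n∸m]≡n; +-comm)
  lt : (m ∸ r) + toℕ i < m
  lt = subst ((m ∸ r) + toℕ i <_) (m∸n+n≡m r≤m) (Data.Nat.Properties.+-monoʳ-< (m ∸ r) (toℕ<n i))

bisuffix : ∀ {q m} (T : Mat q m) (r : ℕ) → r ≤ m → Mat q r
bisuffix T r r≤m i j = T (sufIdx r≤m i) (sufIdx r≤m j)

IsBibifix : ∀ {q m} (T : Mat q m) (r : ℕ) → Mat q r → Set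
IsBibifix {q} {m} T r B =
  Σ (1 ≤ r) λ _ → Σ (r < m) λ r<m →
    (B ≈ₘ biprefix T r (<⇒≤ r<m)) × (B ≈ₘ bisuffix T r (<⇒≤ r<m))

BBF : ∀ q m → Mat q m → Set
BBF q m T = ¬ (Σ ℕ λ r → Σ (Mat q r) λ B → IsBibifix T r B)

-- ψ(M) for an n×n matrix M: T' ∈ ψ(M) iff T' agrees with M off the
-- inserted row and column at 0-based position h = ⌊n/2⌋.
-- punchOut {i = h} maps i < h to i and i > h to i - 1 (this is ι).
Inψ : ∀ {q n} (h : Fin (suc n)) (M : Mat q n) (T' : Mat q (suc n)) → Set
Inψ h M T' = ∀ i j (i≢h : h ≢ i) (j≢h : h ≢ j) →
  T' i j ≡ M (punchOut i≢h) (punchOut j≢h)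

module Submission where

-- Call (r, d) a border of an a×a matrix M when the r×r block
-- of M at offset (0,0) equals the r×r block at offset (d,d); a bibifix of
-- dimension r is exactly a border (r, a − r) with 1 ≤ r < a.  As for
-- string borders, an overlapping border (s + d, d) yields the border
-- (s, 2d), so every border shrinks to a short one (r ≤ d); and a border of
-- the biprefix of size r composed with a border (r, d) of M is a border
-- of M.  If T' ∈ ψ(M) with insertion at h, a border (r, c + 1) of T' with
-- r ≤ h ≤ c avoids the inserted row and column and is a border (r, c) of M.
-- For n = 2k + 1 and M bibifix-free, T' thus has no border of size ≤ k, so
-- every bibifix of T' shrinks to the central border (k + 1, k + 1).  Its
-- biprefix is then the unique (k+1)×(k+1) bibifix of T', and it is
-- bibifix-free since its borders compose to small borders of T'.
-- Entries are read at ℕ indices with a default value outside the matrix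
-- (this is where q ≥ 1 is used), keeping the index arithmetic inside ℕ.

open import Defs
open import Data.Nat using (ℕ; zero; suc; _+_; _*_; _∸_; _≤_; _<_; s≤s; z≤n; _<?_; _≤?_)
open import Data.Nat.Properties
open import Data.Nat.Induction using (<-rec)
open import Algebra.Properties.CommutativeSemigroup +-commutativeSemigroup using (x∙yz≈y∙xz)
open import Data.Fin using (Fin; fromℕ<; toℕ; punchOut)
import Data.Fin as Fin
open import Data.Fin.Properties using (toℕ<n; toℕ-fromℕ<; fromℕ<-toℕ)
open import Data.Product using (Σ; _×_; ∃!; _,_)
open import Data.Sum using (inj₁; inj₂)
open import Data.Empty using (⊥-elim)
open import Relation.Nullary using (¬_; yes; no)
open import Relation.Nullary.Decidable using (decidable-stable)
open import Relation.Binary.PropositionalEquality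
open import Function.Bundles using (_⇔_; mk⇔)
open ≡-Reasoning

toℕ-punchOut-below : ∀ {n} (h j : Fin (suc n)) (h≢j : h ≢ j) →
                     toℕ j < toℕ h → toℕ (punchOut h≢j) ≡ toℕ j
toℕ-punchOut-below Fin.zero j h≢j ()
toℕ-punchOut-below {suc n} (Fin.suc h) Fin.zero h≢j j<h = refl
toℕ-punchOut-below {suc n} (Fin.suc h) (Fin.suc j) h≢j (s≤s j<h) =
  cong suc (toℕ-punchOut-below h j (λ eq → h≢j (cong Fin.suc eq)) j<h)

toℕ-punchOut-above : ∀ {n} (h j : Fin (suc n)) (h≢j : h ≢ j) →
                     toℕ h < toℕ j → suc (toℕ (punchOut h≢j)) ≡ toℕ j
toℕ-punchOut-above Fin.zero Fin.zero h≢j ()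
toℕ-punchOut-above Fin.zero (Fin.suc j) h≢j h<j = refl
toℕ-punchOut-above {suc n} (Fin.suc h) Fin.zero h≢j ()
toℕ-punchOut-above {suc n} (Fin.suc h) (Fin.suc j) h≢j (s≤s h<j) =
  cong suc (toℕ-punchOut-above h j (λ eq → h≢j (cong Fin.suc eq)) h<j)

<-inside : ∀ {i s} d → i < s → i < s + d
<-inside {s = s} d i<s = ≤-trans i<s (m≤m+n s d)

<-shifted : ∀ {i s} d → i < s → d + i < s + d
<-shifted {i} {s} d i<s = subst (d + i <_) (+-comm d s) (+-monoʳ-< d i<s)

≤-half : ∀ {r d s} → r ≤ d → r + d ≡ s + s → r ≤ s
≤-half {r} {d} {s} r≤d r+d≡s+s with r ≤? s
... | yes r≤s = r≤s
... | no r≰s  = ⊥-elim (<-irrefl (sym r+d≡s+s) (+-mono-< s<r (<-≤-trans s<r r≤d)))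
  where
  s<r : s < r
  s<r = ≰⇒> r≰s

module Borders {q : ℕ} (default : Fin q) where

  entry : ∀ {a} → Mat q a → ℕ → ℕ → Fin q
  entry {a} M i j with i <? a | j <? a
  ... | yes i<a | yes j<a = M (fromℕ< i<a) (fromℕ< j<a)
  ... | _       | _       = default

  entry-≡ : ∀ {a} (M : Mat q a) (x y : Fin a) {i j} →
            toℕ x ≡ i → toℕ y ≡ j → entry M i j ≡ M x y
  entry-≡ {a} M x y refl refl with toℕ x <? a | toℕ y <? a
  ... | yes x<a | yes y<a = cong₂ M (fromℕ<-toℕ x x<a) (fromℕ<-toℕ y y<a)
  ... | no x≮a  | _       = ⊥-elim (x≮a (toℕ<n x))
  ... | yes _   | no y≮a  = ⊥-elim (y≮a (toℕ<n y))

  Border : ∀ {a} → Mat q a → ℕ → ℕ → Set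
  Border M r d = ∀ i j → i < r → j < r → entry M i j ≡ entry M (d + i) (d + j)

  -- Being a border is a finite conjunction of decidable equalities, hence
  -- stable under double negation; this lets us leave "¬ BBF" constructively.
  border-stable : ∀ {a} {M : Mat q a} {r d} → ¬ ¬ Border M r d → Border M r d
  border-stable ¬¬border i j i<r j<r =
    decidable-stable (_ Fin.≟ _) λ ≢ → ¬¬border λ border → ≢ (border i j i<r j<r)

  bibifix-prefix : ∀ {a} {M : Mat q a} {r} {B : Mat q r} → IsBibifix M r B →
                   ∀ x y → B x y ≡ entry M (toℕ x) (toℕ y)
  bibifix-prefix {M = M} (_ , _ , B≈pre , _) x y =
    trans (B≈pre x y) (sym (entry-≡ M _ _ (toℕ-fromℕ< _) (toℕ-fromℕ< _)))

  bibifix-suffix : ∀ {a} {M : Mat q a} {r} {B : Mat q r} → IsBibifix M r B →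
                   ∀ x y → B x y ≡ entry M ((a ∸ r) + toℕ x) ((a ∸ r) + toℕ y)
  bibifix-suffix {M = M} (_ , _ , _ , B≈suf) x y =
    trans (B≈suf x y) (sym (entry-≡ M _ _ (toℕ-fromℕ< _) (toℕ-fromℕ< _)))

  bibifix-unique : ∀ {a} {M : Mat q a} {r} {B C : Mat q r} →
                   IsBibifix M r B → IsBibifix M r C → B ≈ₘ C
  bibifix-unique {M = M} B-bib C-bib x y =
    trans (bibifix-prefix {M = M} B-bib x y) (sym (bibifix-prefix {M = M} C-bib x y))

  bibifix→border : ∀ {a} {M : Mat q a} {r} {B : Mat q r} →
                   IsBibifix M r B → Border M r (a ∸ r)
  bibifix→border {a} {M} {r} {B} bib i j i<r j<r = begin
    entry M i j                         ≡⟨ cong₂ (entry M) (sym (toℕ-fromℕ< i<r)) (sym (toℕ-fromℕ< j<r)) ⟩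
    entry M (toℕ x) (toℕ y)             ≡⟨ sym (bibifix-prefix bib x y) ⟩
    B x y                               ≡⟨ bibifix-suffix bib x y ⟩
    entry M (d + toℕ x) (d + toℕ y)     ≡⟨ cong₂ (entry M) (cong (d +_) (toℕ-fromℕ< i<r)) (cong (d +_) (toℕ-fromℕ< j<r)) ⟩
    entry M (d + i) (d + j)             ∎
    where
    x y : Fin r
    x = fromℕ< i<r
    y = fromℕ< j<r
    d : ℕ
    d = a ∸ r

  border→bibifix : ∀ {a} {M : Mat q a} {r d} → 1 ≤ r → (r<a : r < a) → r + d ≡ a →
                   Border M r d → IsBibifix M r (biprefix M r (<⇒≤ r<a))
  border→bibifix {a} {M} {r} {d} 1≤r r<a r+d≡a border =
    1≤r , r<a , (λ _ _ → refl) , λ x y → begin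
      biprefix M r r≤a x y               ≡⟨ sym (entry-≡ M _ _ (toℕ-fromℕ< _) (toℕ-fromℕ< _)) ⟩
      entry M (toℕ x) (toℕ y)            ≡⟨ border (toℕ x) (toℕ y) (toℕ<n x) (toℕ<n y) ⟩
      entry M (d + toℕ x) (d + toℕ y)    ≡⟨ entry-≡ M _ _ (suffix-index x) (suffix-index y) ⟩
      bisuffix M r r≤a x y               ∎
    where
    r≤a = <⇒≤ r<a
    a∸r≡d : a ∸ r ≡ d
    a∸r≡d = trans (cong (_∸ r) (sym r+d≡a)) (m+n∸m≡n r d)
    suffix-index : ∀ x → toℕ (sufIdx (<⇒≤ r<a) x) ≡ d + toℕ x
    suffix-index x = trans (toℕ-fromℕ< _) (cong (_+ toℕ x) a∸r≡d)

  bbf-no-border : ∀ {a} {M : Mat q a} {r d} → BBF q a M →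
                  1 ≤ r → 1 ≤ d → r + d ≡ a → ¬ Border M r d
  bbf-no-border {M = M} {r} bbf 1≤r 1≤d r+d≡a border =
    bbf (r , _ , border→bibifix 1≤r r<a r+d≡a border)
    where
    r<a : r < _
    r<a = subst (r <_) r+d≡a (m<m+n r 1≤d)

  border-overlap : ∀ {a} {M : Mat q a} {s d} → Border M (s + d) d → Border M s (d + d)
  border-overlap {M = M} {s} {d} border i j i<s j<s = begin
    entry M i j                   ≡⟨ border i j (<-inside d i<s) (<-inside d j<s) ⟩
    entry M (d + i) (d + j)       ≡⟨ border (d + i) (d + j) (<-shifted d i<s) (<-shifted d j<s) ⟩
    entry M (d + (d + i)) (d + (d + j)) ≡⟨ cong₂ (entry M) (sym (+-assoc d d i)) (sym (+-assoc d d j)) ⟩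
    entry M (d + d + i) (d + d + j) ∎

  ShortBorder : ∀ {a} → Mat q a → ℕ → Set
  ShortBorder M n = Σ ℕ λ r → Σ ℕ λ d → 1 ≤ r × r ≤ d × r + d ≡ n × Border M r d

  shorten-border : ∀ {a} {M : Mat q a} r {d} → 1 ≤ r → 1 ≤ d →
                   Border M r d → ShortBorder M (r + d)
  shorten-border {M = M} = <-rec Shortenable shorten
    where
    Shortenable : ℕ → Set
    Shortenable r = ∀ {d} → 1 ≤ r → 1 ≤ d → Border M r d → ShortBorder M (r + d)
    shorten : ∀ r → (∀ {s} → s < r → Shortenable s) → Shortenable r
    shorten r recurse {d} 1≤r 1≤d border with r ≤? d
    ... | yes r≤d = r , d , 1≤r , r≤d , refl , border
    ... | no r≰d  = subst (ShortBorder M) total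
                      (recurse s<r 1≤s (≤-trans 1≤d (m≤m+n d d))
                        (border-overlap {M = M} {s = s} {d = d} (subst (λ t → Border M t d) r≡s+d border)))
      where
      d≤r : d ≤ r
      d≤r = <⇒≤ (≰⇒> r≰d)
      s : ℕ
      s = r ∸ d
      r≡s+d : r ≡ s + d
      r≡s+d = sym (m∸n+n≡m d≤r)
      s<r : s < r
      s<r = ∸-monoʳ-< 1≤d d≤r
      1≤s : 1 ≤ s
      1≤s = m<n⇒0<n∸m (≰⇒> r≰d)
      total : s + (d + d) ≡ r + d
      total = trans (sym (+-assoc s d d)) (cong (_+ d) (sym r≡s+d))

  biprefix-entry : ∀ {a} (M : Mat q a) r (r≤a : r ≤ a) {i j} → i < r → j < r →
                   entry (biprefix M r r≤a) i j ≡ entry M i j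
  biprefix-entry M r r≤a i<r j<r =
    trans (entry-≡ _ (fromℕ< i<r) (fromℕ< j<r) (toℕ-fromℕ< _) (toℕ-fromℕ< _))
      (sym (entry-≡ M _ _ (trans (toℕ-fromℕ< _) (toℕ-fromℕ< i<r))
                          (trans (toℕ-fromℕ< _) (toℕ-fromℕ< j<r))))

  border-compose : ∀ {a} (M : Mat q a) {r d} (r≤a : r ≤ a) {t e} → t + e ≤ r →
                   Border M r d → Border (biprefix M r r≤a) t e → Border M t (d + e)
  border-compose M {r} {d} r≤a {t} {e} t+e≤r outer inner i j i<t j<t = begin
    entry M i j                   ≡⟨ sym (biprefix-entry M r r≤a (inside i<t) (inside j<t)) ⟩
    entry P i j                   ≡⟨ inner i j i<t j<t ⟩
    entry P (e + i) (e + j)       ≡⟨ biprefix-entry M r r≤a (shifted i<t) (shifted j<t) ⟩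
    entry M (e + i) (e + j)       ≡⟨ outer (e + i) (e + j) (shifted i<t) (shifted j<t) ⟩
    entry M (d + (e + i)) (d + (e + j)) ≡⟨ cong₂ (entry M) (sym (+-assoc d e i)) (sym (+-assoc d e j)) ⟩
    entry M (d + e + i) (d + e + j) ∎
    where
    P : Mat q r
    P = biprefix M r r≤a
    inside : ∀ {i} → i < t → i < r
    inside i<t = <-≤-trans (<-inside e i<t) t+e≤r
    shifted : ∀ {i} → i < t → e + i < r
    shifted i<t = <-≤-trans (<-shifted e i<t) t+e≤r

module Insertion {q n : ℕ} (default : Fin q) (h : Fin (suc n))
                 {M : Mat q n} {T' : Mat q (suc n)} (inψ : Inψ h M T') where
  open Borders default

  entry-below : ∀ {i j} → i < toℕ h → j < toℕ h → entry T' i j ≡ entry M i j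
  entry-below {i} {j} i<h j<h =
    trans (entry-≡ T' x y x≡ y≡)
      (trans (inψ x y (h≢ x<h) (h≢ y<h))
        (sym (entry-≡ M _ _ (trans (toℕ-punchOut-below h x _ x<h) x≡)
                            (trans (toℕ-punchOut-below h y _ y<h) y≡))))
    where
    i<1+n : i < suc n
    i<1+n = <-trans i<h (toℕ<n h)
    j<1+n : j < suc n
    j<1+n = <-trans j<h (toℕ<n h)
    x y : Fin (suc n)
    x = fromℕ< i<1+n
    y = fromℕ< j<1+n
    x≡ : toℕ x ≡ i
    x≡ = toℕ-fromℕ< i<1+n
    y≡ : toℕ y ≡ j
    y≡ = toℕ-fromℕ< j<1+n
    x<h : toℕ x < toℕ h
    x<h = subst (_< toℕ h) (sym x≡) i<h
    y<h : toℕ y < toℕ h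
    y<h = subst (_< toℕ h) (sym y≡) j<h
    h≢ : ∀ {z} → toℕ z < toℕ h → h ≢ z
    h≢ z<h h≡z = <⇒≢ z<h (sym (cong toℕ h≡z))

  entry-above : ∀ {i j} → toℕ h ≤ i → toℕ h ≤ j → i < n → j < n →
                entry T' (suc i) (suc j) ≡ entry M i j
  entry-above {i} {j} h≤i h≤j i<n j<n =
    trans (entry-≡ T' x y x≡ y≡)
      (trans (inψ x y (h≢ h<x) (h≢ h<y))
        (sym (entry-≡ M _ _ (suc-injective (trans (toℕ-punchOut-above h x _ h<x) x≡))
                            (suc-injective (trans (toℕ-punchOut-above h y _ h<y) y≡)))))
    where
    x y : Fin (suc n)
    x = fromℕ< (s≤s i<n)
    y = fromℕ< (s≤s j<n)
    x≡ : toℕ x ≡ suc i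
    x≡ = toℕ-fromℕ< (s≤s i<n)
    y≡ : toℕ y ≡ suc j
    y≡ = toℕ-fromℕ< (s≤s j<n)
    h<x : toℕ h < toℕ x
    h<x = subst (toℕ h <_) (sym x≡) (s≤s h≤i)
    h<y : toℕ h < toℕ y
    h<y = subst (toℕ h <_) (sym y≡) (s≤s h≤j)
    h≢ : ∀ {z} → toℕ h < toℕ z → h ≢ z
    h≢ h<z h≡z = <⇒≢ h<z (cong toℕ h≡z)

  border-descends : ∀ {r c} → r ≤ toℕ h → toℕ h ≤ c → r + c ≡ n →
                    Border T' r (suc c) → Border M r c
  border-descends {r} {c} r≤h h≤c r+c≡n border i j i<r j<r = begin
    entry M i j                       ≡⟨ sym (entry-below (<-≤-trans i<r r≤h) (<-≤-trans j<r r≤h)) ⟩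
    entry T' i j                      ≡⟨ border i j i<r j<r ⟩
    entry T' (suc (c + i)) (suc (c + j)) ≡⟨ entry-above (above i) (above j) (inside i<r) (inside j<r) ⟩
    entry M (c + i) (c + j)           ∎
    where
    above : ∀ i → toℕ h ≤ c + i
    above i = ≤-trans h≤c (m≤m+n c i)
    inside : ∀ {i} → i < r → c + i < n
    inside i<r = subst (_ <_) (trans (+-comm c r) r+c≡n) (+-monoʳ-< c i<r)

module Centre {q : ℕ} (default : Fin q) (k : ℕ)
              (T : Mat q (suc (2 * k))) (bbf : BBF q (suc (2 * k)) T)
              (T' : Mat q (suc (suc (2 * k))))
              (h : Fin (suc (suc (2 * k)))) (h≡k : toℕ h ≡ k) (inψ : Inψ h T T') where
  open Borders default
  open Insertion default h {T} {T'} inψ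

  2k≡k+k : 2 * k ≡ k + k
  2k≡k+k = cong (k +_) (+-identityʳ k)

  m≡k+1+k+1 : suc (suc (2 * k)) ≡ suc k + suc k
  m≡k+1+k+1 = cong suc (trans (cong suc 2k≡k+k) (sym (+-suc k k)))

  k+1<m : suc k < suc (suc (2 * k))
  k+1<m = s≤s (s≤s (m≤m+n k (k + 0)))

  -- T' has no border of size at most k: its shift exceeds k, so it would
  -- descend to a border of the bibifix-free T.
  no-small-border : ∀ {r d} → 1 ≤ r → r ≤ k → r + d ≡ suc (suc (2 * k)) → ¬ Border T' r d
  no-small-border {r} {zero} 1≤r r≤k r+0≡m _ =
    <⇒≱ (<-trans (n<1+n k) k+1<m) (subst (_≤ k) (trans (sym (+-identityʳ r)) r+0≡m) r≤k)
  no-small-border {r} {suc c} 1≤r r≤k r+d≡m border =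
    bbf-no-border bbf 1≤r (≤-trans 1≤r (≤-trans r≤k k≤c)) r+c≡n
      (border-descends (subst (r ≤_) (sym h≡k) r≤k) (subst (_≤ c) (sym h≡k) k≤c) r+c≡n border)
    where
    r+c≡n : r + c ≡ suc (2 * k)
    r+c≡n = suc-injective (trans (sym (+-suc r c)) r+d≡m)
    k≤c : k ≤ c
    k≤c = <⇒≤ (+-cancelˡ-< k k c (≤-<-trans (≤-reflexive (sym 2k≡k+k))
            (subst (_≤ k + c) r+c≡n (+-monoˡ-≤ c r≤k))))

  short-border-central : ShortBorder T' (suc k + suc k) → Border T' (suc k) (suc k)
  short-border-central (r , d , 1≤r , r≤d , r+d≡k+1+k+1 , border)
    with m≤n⇒m<n∨m≡n (≤-half r≤d r+d≡k+1+k+1)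
  ... | inj₁ r<k+1 = ⊥-elim (no-small-border 1≤r (≤-pred r<k+1) r+d≡m border)
    where
    r+d≡m : r + d ≡ suc (suc (2 * k))
    r+d≡m = trans r+d≡k+1+k+1 (sym m≡k+1+k+1)
  ... | inj₂ refl  = subst (Border T' (suc k)) (+-cancelˡ-≡ (suc k) d (suc k) r+d≡k+1+k+1) border

  central-border : ∀ {r} {B : Mat q r} → IsBibifix T' r B → Border T' (suc k) (suc k)
  central-border {r} bib@(1≤r , r<m , _) =
    short-border-central (subst (ShortBorder T') total
      (shorten-border {M = T'} r {d = suc (suc (2 * k)) ∸ r} 1≤r (m<n⇒0<n∸m r<m)
        (bibifix→border {M = T'} bib)))
    where
    total : r + (suc (suc (2 * k)) ∸ r) ≡ suc k + suc k
    total = trans (m+[n∸m]≡n (<⇒≤ r<m)) m≡k+1+k+1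

  central : Mat q (suc k)
  central = biprefix T' (suc k) (<⇒≤ k+1<m)

  central-bibifix : Border T' (suc k) (suc k) → IsBibifix T' (suc k) central
  central-bibifix = border→bibifix (s≤s z≤n) k+1<m (sym m≡k+1+k+1)

  -- A bibifix of the central biprefix would give T' a border of size ≤ k.
  central-bbf : Border T' (suc k) (suc k) → BBF q (suc k) central
  central-bbf border (t , _ , bib@(1≤t , t<k+1 , _)) =
    no-small-border 1≤t (≤-pred t<k+1) total
      (border-compose T' {d = suc k} (<⇒≤ k+1<m) {t} {e} (≤-reflexive t+e≡k+1) border
        (bibifix→border {M = central} bib))
    where
    e : ℕ
    e = suc k ∸ t
    t+e≡k+1 : t + e ≡ suc k
    t+e≡k+1 = m+[n∸m]≡n (<⇒≤ t<k+1)
    total : t + (suc k + e) ≡ suc (suc (2 * k))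
    total = trans (x∙yz≈y∙xz t (suc k) e)
              (trans (cong (suc k +_) t+e≡k+1) (sym m≡k+1+k+1))

  characterisation :
    (¬ BBF q (suc (suc (2 * k))) T') ⇔
    ∃! _≈ₘ_ (λ (B : Mat q (suc k)) → IsBibifix T' (suc k) B × BBF q (suc k) B)
  characterisation = mk⇔ unique-central-bibifix has-bibifix
    where
    unique-central-bibifix : ¬ BBF q (suc (suc (2 * k))) T' →
      ∃! _≈ₘ_ (λ (B : Mat q (suc k)) → IsBibifix T' (suc k) B × BBF q (suc k) B)
    unique-central-bibifix ¬bbf =
      central , (central-bibifix border , central-bbf border) ,
      λ (bib , _) → bibifix-unique {M = T'} (central-bibifix border) bib
      where
      border : Border T' (suc k) (suc k)
      border = border-stable {M = T'} {suc k} {suc k} λ ¬border →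
        ¬bbf λ (_ , _ , bib) → ¬border (central-border bib)
    has-bibifix : ∃! _≈ₘ_ (λ (B : Mat q (suc k)) → IsBibifix T' (suc k) B × BBF q (suc k) B) →
                  ¬ BBF q (suc (suc (2 * k))) T'
    has-bibifix (B , (bib , _) , _) bbf′ = bbf′ (suc k , B , bib)

proposition3p1 : (q : ℕ) → 1 ≤ q → (k : ℕ) →
    (T : Mat q (suc (2 * k))) → BBF q (suc (2 * k)) T →
    (T' : Mat q (suc (suc (2 * k)))) →
    Inψ (fromℕ< {k} {suc (suc (2 * k))} (s≤s (≤-trans (m≤m+n k (k + 0)) (n≤1+n (2 * k))))) T T' →
    ((¬ BBF q (suc (suc (2 * k))) T') ⇔
      ∃! _≈ₘ_ (λ (B : Mat q (suc k)) → IsBibifix T' (suc k) B × BBF q (suc k) B))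
proposition3p1 q 1≤q k T bbf T' inψ =
  Centre.characterisation (fromℕ< 1≤q) k T bbf T' _ (toℕ-fromℕ< _) inψ
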